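{- Let $1\le n<m$, $q\in\mathbb C\setminus\{0\}$, and let $A=(a_{ij})_{m\times m}$ have non-commuting variable entries. For $n<i',j'\le m$ let $c_{i'j'}=a_{i'j'}+a_{i'*}(I-q^{ -1}A_0)^{ -1}(q^{ -1}a_{*j'})$ and $C=(c_{i'j'})_{n+1\le i',j'\le m}$. Fix $i,j\in\{n+1,\dots,m\}$. Then for all $i',j'\in\{n+1,\dots,m\}$, $$\big((I-A_{[ij]})^{ -1}\big)_{i'j'}=\big((I-C_{[ij]})^{ -1}\big)_{i'j'}.$$
   Context: Work in the $\mathbb C$-algebra of formal power series in non-commuting variables $a_{ij}$, $1\le i,j\le m$ (no relations imposed). $A_0=(a_{ij})_{1\le i,j\le n}$, $a_{i*}=(a_{i1},\dots,a_{in})$, $a_{*j}=(a_{1j},\dots,a_{nj})^T$, and $(I-X)^{ -1}=\sum_{k\ge0}X^k$. For a matrix $X=(x_{kl})$ indexed by a set of integers, $X_{[ij]}$ is the matrix with entries $(X_{[ij]})_{kl}=q^{\epsilon(k,l)}x_{kl}$, where $\epsilon(k,l)=[l>j]-[k<i]$ (Iverson brackets); i.e. entries in rows $k<i$ are multiplied by $q^{ -1}$ and entries in columns $l>j$ by $q$. Here $A_{[ij]}$ is indexed by $\{1,\dots,m\}$ and $C_{[ij]}$ by $\{n+1,\dots,m\}$. -}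

module Defs where

open import Level using (Level)
open import Function using (id)
open import Algebra.Bundles using (CommutativeRing)
open import Data.Nat using (ℕ; zero; suc; _<ᵇ_) renaming (_+_ to _+ℕ_)
open import Data.Fin using (Fin; toℕ; _↑ˡ_; _↑ʳ_)
open import Data.Fin.Properties using (_≟_)
open import Data.List using (List; []; _∷_; length; map; foldr)
open import Data.Product using (_×_; _,_)
open import Data.Bool using (Bool; true; false; if_then_else_; _∧_)
open import Relation.Nullary.Decidable using (does)

-- Formal power series in non-commuting variables a_{ij} (i,j : Fin m), with
-- coefficients in a commutative ring R: a series is its coefficient function on
-- words (finite sequences of letters).  Index conventions: Fin m is 0-based,
-- the paper's index k corresponds to toℕ k + 1.
module PowerSeries {c ℓ : Level} (R : CommutativeRing c ℓ) where
  open CommutativeRing R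

  Letter : ℕ → Set
  Letter m = Fin m × Fin m

  Word : ℕ → Set
  Word m = List (Letter m)

  PS : ℕ → Set c
  PS m = Word m → Carrier

  splits : {m : ℕ} → Word m → List (Word m × Word m)
  splits [] = ([] , []) ∷ []
  splits (x ∷ w) = ([] , x ∷ w) ∷ map (λ { (u , v) → (x ∷ u , v) }) (splits w)

  sumList : List Carrier → Carrier
  sumList = foldr _+_ 0#

  _⊕_ : {m : ℕ} → PS m → PS m → PS m
  (f ⊕ g) w = f w + g w

  _⊛_ : {m : ℕ} → PS m → PS m → PS m
  (f ⊛ g) w = sumList (map (λ { (u , v) → f u * g v }) (splits w))

  scale : {m : ℕ} → Carrier → PS m → PS m
  scale r f w = r * f w

  zeroPS : {m : ℕ} → PS m
  zeroPS _ = 0#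

  onePS : {m : ℕ} → PS m
  onePS [] = 1#
  onePS (_ ∷ _) = 0#

  letterEq : {m : ℕ} → Letter m → Letter m → Bool
  letterEq (i , j) (k , l) = does (i ≟ k) ∧ does (j ≟ l)

  var : {m : ℕ} → Fin m → Fin m → PS m
  var i j [] = 0#
  var i j (x ∷ []) = if letterEq (i , j) x then 1# else 0#
  var i j (_ ∷ _ ∷ _) = 0#

  Mat : ℕ → ℕ → Set c
  Mat m k = Fin k → Fin k → PS m

  sumFin : {m k : ℕ} → (Fin k → PS m) → PS m
  sumFin {k = zero} f = zeroPS
  sumFin {k = suc k} f = f Fin.zero ⊕ sumFin (λ r → f (Fin.suc r))
    where import Data.Fin as Fin

  matMul : {m k : ℕ} → Mat m k → Mat m k → Mat m k
  matMul X Y a b = sumFin (λ r → X a r ⊛ Y r b)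

  idMat : {m k : ℕ} → Mat m k
  idMat a b = if does (a ≟ b) then onePS else zeroPS

  scaleMat : {m k : ℕ} → Carrier → Mat m k → Mat m k
  scaleMat r X a b = scale r (X a b)

  matPow : {m k : ℕ} → Mat m k → ℕ → Mat m k
  matPow X zero = idMat
  matPow X (suc t) = matMul X (matPow X t)

  sumUpTo : (ℕ → Carrier) → ℕ → Carrier
  sumUpTo f zero = f 0
  sumUpTo f (suc t) = sumUpTo f t + f (suc t)

  -- (I - X)^{-1} = Σ_{t ≥ 0} X^t, for X whose entries have zero constant term:
  -- then X^t contributes nothing to the coefficient of a word of length < t,
  -- so the coefficient of w is the finite sum over t ≤ length w.
  invIminus : {m k : ℕ} → Mat m k → Mat m k
  invIminus X a b w = sumUpTo (λ t → matPow X t a b w) (length w)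

  -- X_[ij]: entries in rows k < i multiplied by q⁻¹ (here qinv), entries in
  -- columns l > j multiplied by q.  `lab` gives the integer label of an index.
  twist : {m k : ℕ} → Carrier → Carrier → (Fin k → ℕ) → Fin k → Fin k → Mat m k → Mat m k
  twist q qinv lab i j X a b =
    (if lab a <ᵇ lab i then scale qinv else id)
      ((if lab j <ᵇ lab b then scale q else id) (X a b))

  -- Setting: m = n + p.  Labels: A is indexed by {1..m}, C by {n+1..m}.
  labA : (n p : ℕ) → Fin (n +ℕ p) → ℕ
  labA n p a = suc (toℕ a)

  labC : (n p : ℕ) → Fin p → ℕ
  labC n p r = n +ℕ suc (toℕ r)

  Amat : (n p : ℕ) → Mat (n +ℕ p) (n +ℕ p)
  Amat n p a b = var a b

  A0mat : (n p : ℕ) → Mat (n +ℕ p) n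
  A0mat n p k l = var (k ↑ˡ p) (l ↑ˡ p)

  Cmat : (n p : ℕ) → Carrier → Mat (n +ℕ p) p
  Cmat n p qinv r s =
    var (n ↑ʳ r) (n ↑ʳ s) ⊕
    sumFin (λ k → sumFin (λ l →
      var (n ↑ʳ r) (k ↑ˡ p) ⊛
        (invIminus (scaleMat qinv (A0mat n p)) k l ⊛
          scale qinv (var (l ↑ˡ p) (n ↑ʳ s)))))

-- For X without constant terms the coefficient of a word w in (I - X)⁻¹ only involves X^t with
-- t ≤ |w|, so the columns of (I - X)⁻¹ are the unique solutions of Y = e_s + X Y (induction on
-- the length of words).  Write X = [[A, E], [B, D]] along {1..n} ∪ {n+1..m}.  If Z is a column of
-- (I - S)⁻¹ for the Schur complement S = D + B (I - A)⁻¹ E, then (I - A)⁻¹ E Z on top of Z solves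
-- that equation for X, so the lower-right block of (I - X)⁻¹ is (I - S)⁻¹.  For i, j > n the twist
-- turns A into q⁻¹ A and E into q⁻¹ E, while all other factors depend only on the lower row or
-- column and pull out of S; hence the Schur complement of A_[ij] is C_[ij].

module Submission where

open import Defs
open import Algebra.Bundles using (CommutativeRing; Semiring)
import Algebra.Properties.CommutativeSemigroup as CommutativeSemigroupProperties
import Data.Nat as ℕ
open import Data.Nat using (ℕ; zero; suc; _<ᵇ_; _≤_; _<_; _≤′_; ≤′-refl; ≤′-step; z≤n; s≤s)
open import Data.Nat.Properties
  using (+-suc; <-≤-trans; m≤m+n; <-asym; <⇒<ᵇ; <ᵇ⇒<; ≤-refl; ≤-trans; m≤n⇒m≤1+n; ≤⇒≤′; ≤′⇒≤; ≤-pred)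
import Data.Fin as Fin
open Fin using (Fin; _↑ˡ_; _↑ʳ_)
open import Data.List using ([]; _∷_; map; length)
open import Data.List.Properties using (map-∘)
open import Data.Bool using (Bool; true; false; if_then_else_; T)
open import Data.Product using (_,_)
open import Function using (_∘_)
open import Relation.Nullary using (¬_; contradiction)
open import Data.Sum using (_⊎_; inj₁; inj₂; [_,_]′)
open import Data.Fin.Properties using (toℕ-↑ˡ; toℕ-↑ʳ; toℕ<n; join-splitAt; splitAt-↑ˡ; splitAt-↑ʳ)
open import Relation.Binary.PropositionalEquality using (_≡_)
import Relation.Binary.PropositionalEquality as ≡
import Relation.Binary.Reasoning.Setoid as SetoidReasoning
import Algebra.Properties.Semiring.Sum as SemiringSum

module SemiringSumProperties {a ℓ} (S : Semiring a ℓ) where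
  open Semiring S
  open SemiringSum S using (sum; sum-syntax; sum-cong-≋; ∑-comm; *-distribˡ-sum; *-distribʳ-sum)
  open SetoidReasoning setoid

  ∑-↑ˡ-↑ʳ : ∀ n {p} (f : Fin (n ℕ.+ p) → Carrier) →
            sum f ≈ (∑[ k < n ] f (k ↑ˡ p)) + (∑[ t < p ] f (n ↑ʳ t))
  ∑-↑ˡ-↑ʳ zero    f = sym (+-identityˡ (sum f))
  ∑-↑ˡ-↑ʳ (suc n) f = trans (+-congˡ (∑-↑ˡ-↑ʳ n (λ a → f (Fin.suc a)))) (sym (+-assoc _ _ _))

  ∑-*-assoc : ∀ {k k'} (x : Fin k → Carrier) (y : Fin k → Fin k' → Carrier) (z : Fin k' → Carrier) →
              ∑[ t < k' ] ((∑[ l < k ] (x l * y l t)) * z t) ≈ ∑[ l < k ] (x l * (∑[ t < k' ] (y l t * z t)))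
  ∑-*-assoc {k} {k'} x y z = begin
    ∑[ t < k' ] ((∑[ l < k ] (x l * y l t)) * z t)
      ≈⟨ sum-cong-≋ (λ t → *-distribʳ-sum (z t) (λ l → x l * y l t)) ⟩
    ∑[ t < k' ] ∑[ l < k ] ((x l * y l t) * z t)
      ≈⟨ sum-cong-≋ (λ t → sum-cong-≋ (λ l → *-assoc (x l) (y l t) (z t))) ⟩
    ∑[ t < k' ] ∑[ l < k ] (x l * (y l t * z t))
      ≈⟨ ∑-comm (λ t l → x l * (y l t * z t)) ⟩
    ∑[ l < k ] ∑[ t < k' ] (x l * (y l t * z t))
      ≈⟨ sum-cong-≋ (λ l → *-distribˡ-sum (x l) (λ t → y l t * z t)) ⟨
    ∑[ l < k ] (x l * (∑[ t < k' ] (y l t * z t))) ∎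

module Series {c ℓ} (R : CommutativeRing c ℓ) (m : ℕ) where
  open CommutativeRing R
  open PowerSeries R
  open CommutativeSemigroupProperties +-commutativeSemigroup using (interchange)
  open CommutativeSemigroupProperties *-commutativeSemigroup using (x∙yz≈y∙xz)
  open SetoidReasoning setoid

  infix 4 _≐_
  _≐_ : PS m → PS m → Set ℓ
  f ≐ g = ∀ w → f w ≈ g w

  ∂ : Letter m → PS m → PS m
  ∂ l f u = f (l ∷ u)

  private
    sumList-map-cong : {A : Set} {g h : A → Carrier} → (∀ x → g x ≈ h x) →
                       ∀ xs → sumList (map g xs) ≈ sumList (map h xs)
    sumList-map-cong g≈h []       = refl
    sumList-map-cong g≈h (x ∷ xs) = +-cong (g≈h x) (sumList-map-cong g≈h xs)

    sumList-map-zero : {A : Set} {g : A → Carrier} → (∀ x → g x ≈ 0#) →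
                       ∀ xs → sumList (map g xs) ≈ 0#
    sumList-map-zero g≈0 []       = refl
    sumList-map-zero g≈0 (x ∷ xs) =
      trans (+-cong (g≈0 x) (sumList-map-zero g≈0 xs)) (+-identityˡ 0#)

    sumList-map-+ : {A : Set} (g h : A → Carrier) → ∀ xs →
                    sumList (map (λ x → g x + h x) xs) ≈ sumList (map g xs) + sumList (map h xs)
    sumList-map-+ g h []       = sym (+-identityˡ 0#)
    sumList-map-+ g h (x ∷ xs) = trans (+-congˡ (sumList-map-+ g h xs)) (interchange _ _ _ _)

    sumList-map-*ˡ : {A : Set} (r : Carrier) (g : A → Carrier) → ∀ xs →
                     sumList (map (λ x → r * g x) xs) ≈ r * sumList (map g xs)
    sumList-map-*ˡ r g []       = sym (zeroʳ r)
    sumList-map-*ˡ r g (x ∷ xs) = trans (+-congˡ (sumList-map-*ˡ r g xs)) (sym (distribˡ r _ _))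

  ⊛-nil : (f g : PS m) → (f ⊛ g) [] ≈ f [] * g []
  ⊛-nil f g = +-identityʳ _

  ⊛-cons : (f g : PS m) (l : Letter m) (w : Word m) →
           (f ⊛ g) (l ∷ w) ≈ f [] * g (l ∷ w) + (∂ l f ⊛ g) w
  ⊛-cons f g l w = +-congˡ (reflexive (≡.cong sumList (≡.sym (map-∘ (splits w)))))

  ⊛-cong : {f f' g g' : PS m} → f ≐ f' → g ≐ g' → f ⊛ g ≐ f' ⊛ g'
  ⊛-cong f≐f' g≐g' w = sumList-map-cong (λ { (u , v) → *-cong (f≐f' u) (g≐g' v) }) (splits w)

  ⊛-distribˡ : (f g h : PS m) → f ⊛ (g ⊕ h) ≐ (f ⊛ g) ⊕ (f ⊛ h)
  ⊛-distribˡ f g h w =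
    trans (sumList-map-cong (λ { (u , v) → distribˡ (f u) (g v) (h v) }) (splits w))
          (sumList-map-+ (λ { (u , v) → f u * g v }) (λ { (u , v) → f u * h v }) (splits w))

  ⊛-distribʳ : (f g h : PS m) → (g ⊕ h) ⊛ f ≐ (g ⊛ f) ⊕ (h ⊛ f)
  ⊛-distribʳ f g h w =
    trans (sumList-map-cong (λ { (u , v) → distribʳ (f v) (g u) (h u) }) (splits w))
          (sumList-map-+ (λ { (u , v) → g u * f v }) (λ { (u , v) → h u * f v }) (splits w))

  ⊛-zeroˡ : (f : PS m) → zeroPS ⊛ f ≐ zeroPS
  ⊛-zeroˡ f w = sumList-map-zero (λ { (u , v) → zeroˡ (f v) }) (splits w)

  ⊛-zeroʳ : (f : PS m) → f ⊛ zeroPS ≐ zeroPS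
  ⊛-zeroʳ f w = sumList-map-zero (λ { (u , v) → zeroʳ (f u) }) (splits w)

  scale-⊛ : (r : Carrier) (f g : PS m) → scale r f ⊛ g ≐ scale r (f ⊛ g)
  scale-⊛ r f g w =
    trans (sumList-map-cong (λ { (u , v) → *-assoc r (f u) (g v) }) (splits w))
          (sumList-map-*ˡ r (λ { (u , v) → f u * g v }) (splits w))

  ⊛-scale : (r : Carrier) (f g : PS m) → f ⊛ scale r g ≐ scale r (f ⊛ g)
  ⊛-scale r f g w =
    trans (sumList-map-cong (λ { (u , v) → x∙yz≈y∙xz (f u) r (g v) }) (splits w))
          (sumList-map-*ˡ r (λ { (u , v) → f u * g v }) (splits w))

  ⊛-identityˡ : (f : PS m) → onePS ⊛ f ≐ f
  ⊛-identityˡ f []      = trans (⊛-nil onePS f) (*-identityˡ (f []))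
  ⊛-identityˡ f (l ∷ w) = begin
    (onePS ⊛ f) (l ∷ w)                          ≈⟨ ⊛-cons onePS f l w ⟩
    1# * f (l ∷ w) + (∂ l onePS ⊛ f) w            ≈⟨ +-cong (*-identityˡ _) (⊛-zeroˡ f w) ⟩
    f (l ∷ w) + 0#                               ≈⟨ +-identityʳ _ ⟩
    f (l ∷ w)                                    ∎

  ⊛-identityʳ : (f : PS m) → f ⊛ onePS ≐ f
  ⊛-identityʳ f []      = trans (⊛-nil f onePS) (*-identityʳ (f []))
  ⊛-identityʳ f (l ∷ w) = begin
    (f ⊛ onePS) (l ∷ w)                          ≈⟨ ⊛-cons f onePS l w ⟩
    f [] * 0# + (∂ l f ⊛ onePS) w                 ≈⟨ +-cong (zeroʳ _) (⊛-identityʳ (∂ l f) w) ⟩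
    0# + f (l ∷ w)                               ≈⟨ +-identityˡ _ ⟩
    f (l ∷ w)                                    ∎

  -- Induction on the word, using ∂ l (f ⊛ g) = f [] · ∂ l g ⊕ ∂ l f ⊛ g, which is ⊛-cons.
  ⊛-assoc : (f g h : PS m) → (f ⊛ g) ⊛ h ≐ f ⊛ (g ⊛ h)
  ⊛-assoc f g h []      = begin
    ((f ⊛ g) ⊛ h) []        ≈⟨ trans (⊛-nil (f ⊛ g) h) (*-congʳ (⊛-nil f g)) ⟩
    (f [] * g []) * h []    ≈⟨ *-assoc _ _ _ ⟩
    f [] * (g [] * h [])    ≈⟨ trans (⊛-nil f (g ⊛ h)) (*-congˡ (⊛-nil g h)) ⟨
    (f ⊛ (g ⊛ h)) []        ∎
  ⊛-assoc f g h (l ∷ w) = begin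
    ((f ⊛ g) ⊛ h) (l ∷ w)
      ≈⟨ ⊛-cons (f ⊛ g) h l w ⟩
    (f ⊛ g) [] * h (l ∷ w) + (∂ l (f ⊛ g) ⊛ h) w
      ≈⟨ +-cong (*-congʳ (⊛-nil f g)) (⊛-cong (⊛-cons f g l) (λ _ → refl) w) ⟩
    (f [] * g []) * h (l ∷ w) + ((scale (f []) (∂ l g) ⊕ (∂ l f ⊛ g)) ⊛ h) w
      ≈⟨ +-congˡ (trans (⊛-distribʳ h _ _ w) (+-congʳ (scale-⊛ (f []) (∂ l g) h w))) ⟩
    (f [] * g []) * h (l ∷ w) + (f [] * (∂ l g ⊛ h) w + ((∂ l f ⊛ g) ⊛ h) w)
      ≈⟨ +-congˡ (+-congˡ (⊛-assoc (∂ l f) g h w)) ⟩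
    (f [] * g []) * h (l ∷ w) + (f [] * (∂ l g ⊛ h) w + (∂ l f ⊛ (g ⊛ h)) w)
      ≈⟨ sym (+-assoc _ _ _) ⟩
    ((f [] * g []) * h (l ∷ w) + f [] * (∂ l g ⊛ h) w) + (∂ l f ⊛ (g ⊛ h)) w
      ≈⟨ +-congʳ (trans (+-congʳ (*-assoc _ _ _)) (sym (distribˡ _ _ _))) ⟩
    f [] * (g [] * h (l ∷ w) + (∂ l g ⊛ h) w) + (∂ l f ⊛ (g ⊛ h)) w
      ≈⟨ +-congʳ (*-congˡ (⊛-cons g h l w)) ⟨
    f [] * (g ⊛ h) (l ∷ w) + (∂ l f ⊛ (g ⊛ h)) w
      ≈⟨ ⊛-cons f (g ⊛ h) l w ⟨
    (f ⊛ (g ⊛ h)) (l ∷ w) ∎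

  scale-congʳ : (x : Carrier) {f g : PS m} → f ≐ g → scale x f ≐ scale x g
  scale-congʳ x f≐g w = *-congˡ (f≐g w)

  scale-identity : (f : PS m) → scale 1# f ≐ f
  scale-identity f w = *-identityˡ (f w)

  scale-comm : (x y : Carrier) (f : PS m) → scale x (scale y f) ≐ scale y (scale x f)
  scale-comm x y f w = x∙yz≈y∙xz x y (f w)

  scale-⊕ : (x : Carrier) (f g : PS m) → scale x (f ⊕ g) ≐ scale x f ⊕ scale x g
  scale-⊕ x f g w = distribˡ x (f w) (g w)

  scale-sumFin : (x : Carrier) {k : ℕ} (f : Fin k → PS m) → scale x (sumFin f) ≐ sumFin (λ a → scale x (f a))
  scale-sumFin x {zero}  f w = zeroʳ x
  scale-sumFin x {suc k} f w =
    trans (distribˡ x _ _) (+-congˡ (scale-sumFin x (λ a → f (Fin.suc a)) w))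

  sumFin-cong : {k : ℕ} {f g : Fin k → PS m} → (∀ a → f a ≐ g a) → sumFin f ≐ sumFin g
  sumFin-cong {zero}  f≐g w = refl
  sumFin-cong {suc k} f≐g w = +-cong (f≐g Fin.zero w) (sumFin-cong (λ a → f≐g (Fin.suc a)) w)

  seriesSemiring : Semiring c ℓ
  seriesSemiring = record
    { Carrier = PS m
    ; _≈_ = _≐_
    ; _+_ = _⊕_
    ; _*_ = _⊛_
    ; 0# = zeroPS
    ; 1# = onePS
    ; isSemiring = record
      { isSemiringWithoutAnnihilatingZero = record
        { +-isCommutativeMonoid = record
          { isMonoid = record
            { isSemigroup = record
              { isMagma = record
                { isEquivalence = record
                  { refl = λ _ → refl ; sym = λ p w → sym (p w) ; trans = λ p q w → trans (p w) (q w) }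
                ; ∙-cong = λ p q w → +-cong (p w) (q w) }
              ; assoc = λ f g h w → +-assoc (f w) (g w) (h w) }
            ; identity = (λ f w → +-identityˡ (f w)) , (λ f w → +-identityʳ (f w)) }
          ; comm = λ f g w → +-comm (f w) (g w) }
        ; *-cong = ⊛-cong
        ; *-assoc = ⊛-assoc
        ; *-identity = ⊛-identityˡ , ⊛-identityʳ
        ; distrib = ⊛-distribˡ , ⊛-distribʳ }
      ; zero = ⊛-zeroˡ , ⊛-zeroʳ } }

  ⊛-congʳ-≤ : (f : PS m) {g g' : PS m} (w : Word m) →
              (∀ v → length v ≤ length w → g v ≈ g' v) → (f ⊛ g) w ≈ (f ⊛ g') w
  ⊛-congʳ-≤ f []      g≈g' = +-congʳ (*-congˡ (g≈g' [] z≤n))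
  ⊛-congʳ-≤ f {g} {g'} (l ∷ w) g≈g' = begin
    (f ⊛ g) (l ∷ w)                     ≈⟨ ⊛-cons f g l w ⟩
    f [] * g (l ∷ w) + (∂ l f ⊛ g) w     ≈⟨ +-cong (*-congˡ (g≈g' (l ∷ w) ≤-refl))
                                                   (⊛-congʳ-≤ (∂ l f) w (λ v v≤w → g≈g' v (m≤n⇒m≤1+n v≤w))) ⟩
    f [] * g' (l ∷ w) + (∂ l f ⊛ g') w   ≈⟨ ⊛-cons f g' l w ⟨
    (f ⊛ g') (l ∷ w)                    ∎

  ⊛-constantFree : (f g : PS m) → f [] ≈ 0# → (f ⊛ g) [] ≈ 0#
  ⊛-constantFree f g f[]≈0 = trans (⊛-nil f g) (trans (*-congʳ f[]≈0) (zeroˡ (g [])))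

  private
    *-congˡ-by-zero : ∀ {a x y} → a ≈ 0# → a * x ≈ a * y
    *-congˡ-by-zero a≈0 = trans (*-congʳ a≈0) (trans (zeroˡ _) (sym (trans (*-congʳ a≈0) (zeroˡ _))))

  ⊛-congʳ-< : (f : PS m) {g g' : PS m} (w : Word m) → f [] ≈ 0# →
              (∀ v → length v < length w → g v ≈ g' v) → (f ⊛ g) w ≈ (f ⊛ g') w
  ⊛-congʳ-< f {g} {g'} []      f[]≈0 _    =
    trans (⊛-nil f g) (trans (*-congˡ-by-zero f[]≈0) (sym (⊛-nil f g')))
  ⊛-congʳ-< f {g} {g'} (l ∷ w) f[]≈0 g≈g' = begin
    (f ⊛ g) (l ∷ w)                     ≈⟨ ⊛-cons f g l w ⟩
    f [] * g (l ∷ w) + (∂ l f ⊛ g) w     ≈⟨ +-cong (*-congˡ-by-zero f[]≈0)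
                                                   (⊛-congʳ-≤ (∂ l f) w (λ v v≤w → g≈g' v (s≤s v≤w))) ⟩
    f [] * g' (l ∷ w) + (∂ l f ⊛ g') w   ≈⟨ ⊛-cons f g' l w ⟨
    (f ⊛ g') (l ∷ w)                    ∎

module Inverse {c ℓ} (R : CommutativeRing c ℓ) (m : ℕ) where
  private module K = CommutativeRing R
  open PowerSeries R
  open Series R m
  open Semiring seriesSemiring
    using (setoid; refl; sym; trans; reflexive; +-cong; +-congˡ; +-assoc; +-identityˡ; +-identityʳ; *-cong; distribˡ; distribʳ)
  open SemiringSumProperties seriesSemiring using (∑-*-assoc)
  open SemiringSum seriesSemiring using (sum; sum-syntax; sum-cong-≋; ∑-distrib-+; sum-replicate-zero)
  open SetoidReasoning setoid

  private variable
    k : ℕ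

  ConstantFree : Mat m k → Set ℓ
  ConstantFree X = ∀ a b → X a b [] K.≈ K.0#

  SolvesColumn : Mat m k → Fin k → (Fin k → PS m) → Set ℓ
  SolvesColumn {k} X s Y = ∀ a → Y a ≐ idMat a s ⊕ (∑[ c < k ] (X a c ⊛ Y c))

  sumFin≡sum : (f : Fin k → PS m) → sumFin f ≡ sum f
  sumFin≡sum {zero}  f = ≡.refl
  sumFin≡sum {suc k} f = ≡.cong (f Fin.zero ⊕_) (sumFin≡sum (λ a → f (Fin.suc a)))

  sum-cong-at : (w : Word m) {f g : Fin k → PS m} → (∀ a → f a w K.≈ g a w) → sum f w K.≈ sum g w
  sum-cong-at {zero}  w f≈g = K.refl
  sum-cong-at {suc k} w f≈g = K.+-cong (f≈g Fin.zero) (sum-cong-at w (λ a → f≈g (Fin.suc a)))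

  matPow-suc : (X : Mat m k) (t : ℕ) (a b : Fin k) →
               matPow X (suc t) a b ≡ ∑[ c < k ] (X a c ⊛ matPow X t c b)
  matPow-suc X t a b = sumFin≡sum (λ c → X a c ⊛ matPow X t c b)

  sumFin-zero-at : (w : Word m) (f : Fin k → PS m) → (∀ a → f a w K.≈ K.0#) → sumFin f w K.≈ K.0#
  sumFin-zero-at {zero}  w f f≈0 = K.refl
  sumFin-zero-at {suc k} w f f≈0 =
    K.trans (K.+-cong (f≈0 Fin.zero) (sumFin-zero-at w (λ a → f (Fin.suc a)) (λ a → f≈0 (Fin.suc a))))
            (K.+-identityʳ K.0#)

  sumFin-sumFin≐∑∑ : ∀ {k'} (f : Fin k → Fin k' → PS m) →
                     sumFin (λ a → sumFin (f a)) ≐ ∑[ a < k ] ∑[ b < k' ] f a b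
  sumFin-sumFin≐∑∑ f = trans (reflexive (sumFin≡sum (λ a → sumFin (f a))))
                             (sum-cong-≋ (λ a → reflexive (sumFin≡sum (f a))))

  ∑-idMat-⊛ : (a : Fin k) (v : Fin k → PS m) → ∑[ l < k ] (idMat a l ⊛ v l) ≐ v a
  ∑-idMat-⊛ {suc k} Fin.zero    v = trans (+-cong (⊛-identityˡ (v Fin.zero)) ∑0⊛v≐0) (+-identityʳ (v Fin.zero))
    where
      ∑0⊛v≐0 : ∑[ l < k ] (zeroPS ⊛ v (Fin.suc l)) ≐ zeroPS
      ∑0⊛v≐0 = trans (sum-cong-≋ (λ l → ⊛-zeroˡ (v (Fin.suc l)))) (sum-replicate-zero k)
  ∑-idMat-⊛ {suc k} (Fin.suc a) v =
    trans (+-cong (⊛-zeroˡ (v Fin.zero)) (∑-idMat-⊛ a (λ l → v (Fin.suc l)))) (+-identityˡ (v (Fin.suc a)))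

  idMat-↑ʳ-↑ʳ : ∀ n {p} (r t : Fin p) → idMat {m} (n ↑ʳ r) (n ↑ʳ t) ≡ idMat r t
  idMat-↑ʳ-↑ʳ zero    r t = ≡.refl
  idMat-↑ʳ-↑ʳ (suc n) r t = idMat-↑ʳ-↑ʳ n r t

  idMat-↑ˡ-↑ʳ : ∀ {n p} (k : Fin n) (t : Fin p) → idMat {m} (k ↑ˡ p) (n ↑ʳ t) ≡ zeroPS
  idMat-↑ˡ-↑ʳ Fin.zero    t = ≡.refl
  idMat-↑ˡ-↑ʳ (Fin.suc k) t = idMat-↑ˡ-↑ʳ k t

  partialInv : Mat m k → ℕ → Mat m k
  partialInv X N a b w = sumUpTo (λ t → matPow X t a b w) N

  partialInv-suc : (X : Mat m k) (N : ℕ) (a b : Fin k) →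
                   partialInv X (suc N) a b ≐ idMat a b ⊕ (∑[ c < k ] (X a c ⊛ partialInv X N c b))
  partialInv-suc X zero    a b w = K.+-congˡ (K.reflexive (≡.cong (λ f → f w) (matPow-suc X 0 a b)))
  partialInv-suc {k} X (suc N) a b = begin
    partialInv X (suc N) a b ⊕ matPow X (suc (suc N)) a b
      ≈⟨ +-cong (partialInv-suc X N a b) (reflexive (matPow-suc X (suc N) a b)) ⟩
    (idMat a b ⊕ (∑[ c < k ] (X a c ⊛ partialInv X N c b))) ⊕ (∑[ c < k ] (X a c ⊛ matPow X (suc N) c b))
      ≈⟨ +-assoc _ _ _ ⟩
    idMat a b ⊕ ((∑[ c < k ] (X a c ⊛ partialInv X N c b)) ⊕ (∑[ c < k ] (X a c ⊛ matPow X (suc N) c b)))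
      ≈⟨ +-congˡ (sym (∑-distrib-+ (λ c → X a c ⊛ partialInv X N c b) (λ c → X a c ⊛ matPow X (suc N) c b))) ⟩
    idMat a b ⊕ (∑[ c < k ] ((X a c ⊛ partialInv X N c b) ⊕ (X a c ⊛ matPow X (suc N) c b)))
      ≈⟨ +-congˡ (sum-cong-≋ (λ c → sym (distribˡ (X a c) (partialInv X N c b) (matPow X (suc N) c b)))) ⟩
    idMat a b ⊕ (∑[ c < k ] (X a c ⊛ partialInv X (suc N) c b)) ∎

  module _ {X : Mat m k} (X-cf : ConstantFree X) where

    ∑⊛-congʳ-< : ∀ a (w : Word m) {g g' : Fin k → PS m} →
                 (∀ c v → length v < length w → g c v K.≈ g' c v) →
                 (∑[ c < k ] (X a c ⊛ g c)) w K.≈ (∑[ c < k ] (X a c ⊛ g' c)) w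
    ∑⊛-congʳ-< a w g≈g' = sum-cong-at w (λ c → ⊛-congʳ-< (X a c) w (X-cf a c) (g≈g' c))

    ∑⊛-zero-< : ∀ a (w : Word m) {g : Fin k → PS m} →
                (∀ c v → length v < length w → g c v K.≈ K.0#) →
                (∑[ c < k ] (X a c ⊛ g c)) w K.≈ K.0#
    ∑⊛-zero-< a w {g} g≈0 = K.trans (∑⊛-congʳ-< a w {g' = λ _ → zeroPS} g≈0)
      (K.trans (sum-cong-at w (λ c → ⊛-zeroʳ (X a c) w)) (sum-replicate-zero k w))

    matPow-short : ∀ t a b (w : Word m) → length w < t → matPow X t a b w K.≈ K.0#
    matPow-short (suc t) a b w (s≤s w≤t) =
      K.trans (K.reflexive (≡.cong (λ f → f w) (matPow-suc X t a b)))
              (∑⊛-zero-< a w (λ c v v<w → matPow-short t c b v (≤-trans v<w w≤t)))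

    partialInv-stable : ∀ {N} a b (w : Word m) → length w ≤′ N → partialInv X N a b w K.≈ invIminus X a b w
    partialInv-stable a b w ≤′-refl          = K.refl
    partialInv-stable a b w (≤′-step {N} w≤N) =
      K.trans (K.+-cong (partialInv-stable a b w w≤N) (matPow-short (suc N) a b w (s≤s (≤′⇒≤ w≤N))))
              (K.+-identityʳ _)

    invIminus-solvesColumn : ∀ s → SolvesColumn X s (λ a → invIminus X a s)
    invIminus-solvesColumn s a []      =
      K.sym (K.trans (K.+-congˡ (∑⊛-zero-< a [] (λ _ _ ()))) (K.+-identityʳ _))
    invIminus-solvesColumn s a (l ∷ w) =
      K.trans (partialInv-suc X (length w) a s (l ∷ w))
              (K.+-congˡ (∑⊛-congʳ-< a (l ∷ w) (λ c v v<l∷w → partialInv-stable c s v (≤⇒≤′ (≤-pred v<l∷w)))))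

    solvesColumn-unique : ∀ {s Y Y'} → SolvesColumn X s Y → SolvesColumn X s Y' → ∀ a → Y a ≐ Y' a
    solvesColumn-unique {s} {Y} {Y'} Y-sol Y'-sol a w = agree (suc (length w)) a w ≤-refl
      where
        agree : ∀ N a (w : Word m) → length w < N → Y a w K.≈ Y' a w
        agree (suc N) a w (s≤s w≤N) =
          K.trans (Y-sol a w)
            (K.trans (K.+-congˡ (∑⊛-congʳ-< a w (λ c v v<w → agree N c v (≤-trans v<w w≤N))))
                     (K.sym (Y'-sol a w)))

    invIminus-unique : ∀ {s Y} → SolvesColumn X s Y → ∀ a → Y a ≐ invIminus X a s
    invIminus-unique {s} Y-sol = solvesColumn-unique Y-sol (invIminus-solvesColumn s)

    invIminus-⊛-unfold : (a : Fin k) (v : Fin k → PS m) →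
      ∑[ l < k ] (invIminus X a l ⊛ v l) ≐ v a ⊕ (∑[ b < k ] (X a b ⊛ (∑[ l < k ] (invIminus X b l ⊛ v l))))
    invIminus-⊛-unfold a v = begin
      ∑[ l < k ] (invIminus X a l ⊛ v l)
        ≈⟨ sum-cong-≋ (λ l → *-cong (invIminus-solvesColumn l a) refl) ⟩
      ∑[ l < k ] ((idMat a l ⊕ (∑[ b < k ] (X a b ⊛ invIminus X b l))) ⊛ v l)
        ≈⟨ sum-cong-≋ (λ l → distribʳ (v l) (idMat a l) (∑[ b < k ] (X a b ⊛ invIminus X b l))) ⟩
      ∑[ l < k ] ((idMat a l ⊛ v l) ⊕ ((∑[ b < k ] (X a b ⊛ invIminus X b l)) ⊛ v l))
        ≈⟨ ∑-distrib-+ (λ l → idMat a l ⊛ v l) (λ l → (∑[ b < k ] (X a b ⊛ invIminus X b l)) ⊛ v l) ⟩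
      (∑[ l < k ] (idMat a l ⊛ v l)) ⊕ (∑[ l < k ] ((∑[ b < k ] (X a b ⊛ invIminus X b l)) ⊛ v l))
        ≈⟨ +-cong (∑-idMat-⊛ a v) (∑-*-assoc (X a) (invIminus X) v) ⟩
      v a ⊕ (∑[ b < k ] (X a b ⊛ (∑[ l < k ] (invIminus X b l ⊛ v l)))) ∎

  invIminus-cong : {X X' : Mat m k} → ConstantFree X → (∀ a b → X a b ≐ X' a b) →
                   ∀ a b → invIminus X a b ≐ invIminus X' a b
  invIminus-cong {k} {X} {X'} X-cf X≐X' a b = sym (invIminus-unique X-cf X'-column a)
    where
      X'-cf : ConstantFree X'
      X'-cf a b = K.trans (K.sym (X≐X' a b [])) (X-cf a b)
      X'-column : SolvesColumn X b (λ a → invIminus X' a b)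
      X'-column a = trans (invIminus-solvesColumn X'-cf b a)
        (+-congˡ (sum-cong-≋ (λ c → *-cong (sym (X≐X' a c)) refl)))

↑ˡ-↑ʳ-elim : ∀ {a} n {p} (P : Fin (n ℕ.+ p) → Set a) →
             (∀ k → P (k ↑ˡ p)) → (∀ t → P (n ↑ʳ t)) → ∀ i → P i
↑ˡ-↑ʳ-elim n {p} P P-↑ˡ P-↑ʳ i = ≡.subst P (join-splitAt n p i) (by-cases (Fin.splitAt n i))
  where
    by-cases : (x : Fin n ⊎ Fin p) → P (Fin.join n p x)
    by-cases (inj₁ k) = P-↑ˡ k
    by-cases (inj₂ t) = P-↑ʳ t

module SchurComplement {c ℓ} (R : CommutativeRing c ℓ) (m n p : ℕ) where
  private module K = CommutativeRing R
  open PowerSeries R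
  open Series R m
  open Inverse R m
  open Semiring seriesSemiring
    using (setoid; refl; sym; trans; reflexive; +-cong; +-congˡ; +-congʳ; +-comm; +-identityˡ; *-cong; distribʳ)
  open SemiringSum seriesSemiring using (sum; sum-syntax; sum-cong-≋; ∑-distrib-+; *-distribˡ-sum)
  open SemiringSumProperties seriesSemiring using (∑-↑ˡ-↑ʳ; ∑-*-assoc)
  open SetoidReasoning setoid

  module _ (X : Mat m (n ℕ.+ p)) where
    topLeft : Mat m n
    topLeft k l = X (k ↑ˡ p) (l ↑ˡ p)

    topRight : Fin n → Fin p → PS m
    topRight k t = X (k ↑ˡ p) (n ↑ʳ t)

    bottomLeft : Fin p → Fin n → PS m
    bottomLeft r k = X (n ↑ʳ r) (k ↑ˡ p)

    bottomRight : Mat m p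
    bottomRight r t = X (n ↑ʳ r) (n ↑ʳ t)

    -- Summed and bracketed as in Cmat, so that the twisted case matches it term by term.
    schur : Mat m p
    schur r t = bottomRight r t ⊕
      sumFin (λ k → sumFin (λ l → bottomLeft r k ⊛ (invIminus topLeft k l ⊛ topRight l t)))

  module _ {X : Mat m (n ℕ.+ p)} (X-cf : ConstantFree X) where

    schur-constantFree : ConstantFree (schur X)
    schur-constantFree r t =
      K.trans (K.+-cong (X-cf _ _) (sumFin-zero-at [] (λ k → sumFin (BInvE k)) (λ k →
                 sumFin-zero-at [] (BInvE k) (λ l → ⊛-constantFree (B k) (InvE k l) (X-cf _ _)))))
              (K.+-identityʳ K.0#)
      where
        B : Fin n → PS m
        B = bottomLeft X r
        InvE : Fin n → Fin n → PS m
        InvE k l = invIminus (topLeft X) k l ⊛ topRight X l t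
        BInvE : Fin n → Fin n → PS m
        BInvE k l = B k ⊛ InvE k l

    topLeft-constantFree : ConstantFree (topLeft X)
    topLeft-constantFree k l = X-cf (k ↑ˡ p) (l ↑ˡ p)

    schur-⊛-expand : (r : Fin p) (z : Fin p → PS m) →
      ∑[ t < p ] (schur X r t ⊛ z t) ≐
      (∑[ t < p ] (bottomRight X r t ⊛ z t)) ⊕
      (∑[ k < n ] (bottomLeft X r k ⊛ (∑[ l < n ] (invIminus (topLeft X) k l ⊛ (∑[ t < p ] (topRight X l t ⊛ z t))))))
    schur-⊛-expand r z = begin
      ∑[ t < p ] (schur X r t ⊛ z t)
        ≈⟨ sum-cong-≋ (λ t → *-cong (+-congˡ (sumFin-sumFin≐∑∑ (BInvE t))) refl) ⟩
      ∑[ t < p ] ((D t ⊕ (∑[ k < n ] ∑[ l < n ] BInvE t k l)) ⊛ z t)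
        ≈⟨ sum-cong-≋ (λ t → distribʳ (z t) (D t) (∑[ k < n ] ∑[ l < n ] BInvE t k l)) ⟩
      ∑[ t < p ] ((D t ⊛ z t) ⊕ ((∑[ k < n ] ∑[ l < n ] BInvE t k l) ⊛ z t))
        ≈⟨ ∑-distrib-+ (λ t → D t ⊛ z t) (λ t → (∑[ k < n ] ∑[ l < n ] BInvE t k l) ⊛ z t) ⟩
      (∑[ t < p ] (D t ⊛ z t)) ⊕ (∑[ t < p ] ((∑[ k < n ] ∑[ l < n ] BInvE t k l) ⊛ z t))
        ≈⟨ +-congˡ (sum-cong-≋ (λ t → *-cong (sum-cong-≋ (λ k →
             sym (*-distribˡ-sum (B k) (λ l → Inv k l ⊛ E l t)))) refl)) ⟩
      (∑[ t < p ] (D t ⊛ z t)) ⊕ (∑[ t < p ] ((∑[ k < n ] (B k ⊛ (∑[ l < n ] (Inv k l ⊛ E l t)))) ⊛ z t))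
        ≈⟨ +-congˡ (∑-*-assoc B (λ k t → ∑[ l < n ] (Inv k l ⊛ E l t)) z) ⟩
      (∑[ t < p ] (D t ⊛ z t)) ⊕ (∑[ k < n ] (B k ⊛ (∑[ t < p ] ((∑[ l < n ] (Inv k l ⊛ E l t)) ⊛ z t))))
        ≈⟨ +-congˡ (sum-cong-≋ (λ k → *-cong refl (∑-*-assoc (Inv k) E z))) ⟩
      (∑[ t < p ] (D t ⊛ z t)) ⊕ (∑[ k < n ] (B k ⊛ (∑[ l < n ] (Inv k l ⊛ (∑[ t < p ] (E l t ⊛ z t)))))) ∎
      where
        Inv : Mat m n
        Inv = invIminus (topLeft X)
        B : Fin n → PS m
        B = bottomLeft X r
        D : Fin p → PS m
        D = bottomRight X r
        E : Fin n → Fin p → PS m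
        E = topRight X
        BInvE : Fin p → Fin n → Fin n → PS m
        BInvE t k l = B k ⊛ (Inv k l ⊛ E l t)

    module _ (s : Fin p) where

      lowerColumn : Fin p → PS m
      lowerColumn r = invIminus (schur X) r s

      topRight⊛lowerColumn : Fin n → PS m
      topRight⊛lowerColumn l = ∑[ t < p ] (topRight X l t ⊛ lowerColumn t)

      upperColumn : Fin n → PS m
      upperColumn k = ∑[ l < n ] (invIminus (topLeft X) k l ⊛ topRight⊛lowerColumn l)

      column : Fin (n ℕ.+ p) → PS m
      column i = [ upperColumn , lowerColumn ]′ (Fin.splitAt n i)

      column-↑ˡ : ∀ k → column (k ↑ˡ p) ≐ upperColumn k
      column-↑ˡ k = reflexive (≡.cong [ upperColumn , lowerColumn ]′ (splitAt-↑ˡ n k p))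

      column-↑ʳ : ∀ r → column (n ↑ʳ r) ≐ lowerColumn r
      column-↑ʳ r = reflexive (≡.cong [ upperColumn , lowerColumn ]′ (splitAt-↑ʳ n p r))

      ∑⊛column : (x : Fin (n ℕ.+ p) → PS m) →
        ∑[ i < n ℕ.+ p ] (x i ⊛ column i) ≐
        (∑[ k < n ] (x (k ↑ˡ p) ⊛ upperColumn k)) ⊕ (∑[ t < p ] (x (n ↑ʳ t) ⊛ lowerColumn t))
      ∑⊛column x = trans (∑-↑ˡ-↑ʳ n (λ i → x i ⊛ column i))
        (+-cong (sum-cong-≋ (λ k → *-cong refl (column-↑ˡ k))) (sum-cong-≋ (λ t → *-cong refl (column-↑ʳ t))))

      column-solves : SolvesColumn X (n ↑ʳ s) column
      column-solves = ↑ˡ-↑ʳ-elim n _ upper-row lower-row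
        where
          upper-row : ∀ k → column (k ↑ˡ p) ≐
                            idMat (k ↑ˡ p) (n ↑ʳ s) ⊕ (∑[ i < n ℕ.+ p ] (X (k ↑ˡ p) i ⊛ column i))
          upper-row k = begin
            column (k ↑ˡ p)
              ≈⟨ column-↑ˡ k ⟩
            upperColumn k
              ≈⟨ invIminus-⊛-unfold topLeft-constantFree k topRight⊛lowerColumn ⟩
            topRight⊛lowerColumn k ⊕ (∑[ l < n ] (topLeft X k l ⊛ upperColumn l))
              ≈⟨ +-comm _ _ ⟩
            (∑[ l < n ] (topLeft X k l ⊛ upperColumn l)) ⊕ topRight⊛lowerColumn k
              ≈⟨ ∑⊛column (X (k ↑ˡ p)) ⟨
            ∑[ i < n ℕ.+ p ] (X (k ↑ˡ p) i ⊛ column i)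
              ≈⟨ +-identityˡ _ ⟨
            zeroPS ⊕ (∑[ i < n ℕ.+ p ] (X (k ↑ˡ p) i ⊛ column i))
              ≈⟨ +-congʳ (reflexive (idMat-↑ˡ-↑ʳ k s)) ⟨
            idMat (k ↑ˡ p) (n ↑ʳ s) ⊕ (∑[ i < n ℕ.+ p ] (X (k ↑ˡ p) i ⊛ column i)) ∎
          lower-row : ∀ r → column (n ↑ʳ r) ≐
                            idMat (n ↑ʳ r) (n ↑ʳ s) ⊕ (∑[ i < n ℕ.+ p ] (X (n ↑ʳ r) i ⊛ column i))
          lower-row r = begin
            column (n ↑ʳ r)
              ≈⟨ column-↑ʳ r ⟩
            lowerColumn r
              ≈⟨ invIminus-solvesColumn schur-constantFree s r ⟩
            idMat r s ⊕ (∑[ t < p ] (schur X r t ⊛ lowerColumn t))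
              ≈⟨ +-congˡ (schur-⊛-expand r lowerColumn) ⟩
            idMat r s ⊕ ((∑[ t < p ] (bottomRight X r t ⊛ lowerColumn t)) ⊕
                         (∑[ k < n ] (bottomLeft X r k ⊛ upperColumn k)))
              ≈⟨ +-congˡ (trans (+-comm _ _) (sym (∑⊛column (X (n ↑ʳ r))))) ⟩
            idMat r s ⊕ (∑[ i < n ℕ.+ p ] (X (n ↑ʳ r) i ⊛ column i))
              ≈⟨ +-congʳ (reflexive (idMat-↑ʳ-↑ʳ n r s)) ⟨
            idMat (n ↑ʳ r) (n ↑ʳ s) ⊕ (∑[ i < n ℕ.+ p ] (X (n ↑ʳ r) i ⊛ column i)) ∎

    invIminus-schur : (r s : Fin p) → invIminus X (n ↑ʳ r) (n ↑ʳ s) ≐ invIminus (schur X) r s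
    invIminus-schur r s = trans (sym (invIminus-unique X-cf (column-solves s) (n ↑ʳ r))) (column-↑ʳ s r)

module Twisting {c ℓ} (R : CommutativeRing c ℓ) (m : ℕ) where
  open CommutativeRing R
  open PowerSeries R
  open Series R m

  twistFactor : Bool → Carrier → Carrier
  twistFactor b x = if b then x else 1#

  twistFactor-true : ∀ {b} x → T b → twistFactor b x ≡ x
  twistFactor-true {true} x _ = ≡.refl

  twistFactor-false : ∀ {b} x → ¬ T b → twistFactor b x ≡ 1#
  twistFactor-false {false} x _  = ≡.refl
  twistFactor-false {true}  x ¬T = contradiction _ ¬T

  twist≐scale : ∀ {k} (q qinv : Carrier) (lab : Fin k → ℕ) (I J : Fin k) (X : Mat m k) (a b : Fin k) →
    twist q qinv lab I J X a b ≐ scale (twistFactor (lab a <ᵇ lab I) qinv) (scale (twistFactor (lab J <ᵇ lab b) q) (X a b))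
  twist≐scale q qinv lab I J X a b w with lab a <ᵇ lab I | lab J <ᵇ lab b
  ... | true  | true  = refl
  ... | true  | false = *-congˡ (sym (*-identityˡ _))
  ... | false | true  = sym (*-identityˡ _)
  ... | false | false = sym (trans (*-identityˡ _) (*-identityˡ _))

module TwistedSchurComplement {c ℓ} (R : CommutativeRing c ℓ) (n p : ℕ) (q qinv : CommutativeRing.Carrier R)
                              (i j : Fin p) where
  private module K = CommutativeRing R
  open PowerSeries R
  open Series R (n ℕ.+ p)
  open Inverse R (n ℕ.+ p)
  open SchurComplement R (n ℕ.+ p) n p
  open Twisting R (n ℕ.+ p)
  open Semiring seriesSemiring using (setoid; refl; sym; trans; reflexive; +-cong; +-congˡ)
  open SetoidReasoning setoid

  Aᵢⱼ : Mat (n ℕ.+ p) (n ℕ.+ p)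
  Aᵢⱼ = twist q qinv (labA n p) (n ↑ʳ i) (n ↑ʳ j) (Amat n p)

  Cᵢⱼ : Mat (n ℕ.+ p) p
  Cᵢⱼ = twist q qinv (labC n p) i j (Cmat n p qinv)

  ρC : Fin p → K.Carrier
  ρC r = twistFactor (labC n p r <ᵇ labC n p i) qinv

  κC : Fin p → K.Carrier
  κC t = twistFactor (labC n p j <ᵇ labC n p t) q

  labA-↑ʳ : ∀ r → labA n p (n ↑ʳ r) ≡ labC n p r
  labA-↑ʳ r = ≡.trans (≡.cong suc (toℕ-↑ʳ n r)) (≡.sym (+-suc n (Fin.toℕ r)))

  labA-↑ˡ<↑ʳ : ∀ k r → labA n p (k ↑ˡ p) < labA n p (n ↑ʳ r)
  labA-↑ˡ<↑ʳ k r = s≤s (≡.subst₂ _<_ (≡.sym (toℕ-↑ˡ k p)) (≡.sym (toℕ-↑ʳ n r))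
                          (<-≤-trans (toℕ<n k) (m≤m+n n (Fin.toℕ r))))

  ρA : Fin (n ℕ.+ p) → K.Carrier
  ρA a = twistFactor (labA n p a <ᵇ labA n p (n ↑ʳ i)) qinv

  κA : Fin (n ℕ.+ p) → K.Carrier
  κA b = twistFactor (labA n p (n ↑ʳ j) <ᵇ labA n p b) q

  ρA-↑ˡ : ∀ k → ρA (k ↑ˡ p) ≡ qinv
  ρA-↑ˡ k = twistFactor-true qinv (<⇒<ᵇ (labA-↑ˡ<↑ʳ k i))

  κA-↑ˡ : ∀ l → κA (l ↑ˡ p) ≡ K.1#
  κA-↑ˡ l = twistFactor-false q (<-asym (labA-↑ˡ<↑ʳ l j) ∘ <ᵇ⇒< _ _)

  ρA-↑ʳ : ∀ r → ρA (n ↑ʳ r) ≡ ρC r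
  ρA-↑ʳ r = ≡.cong₂ (λ x y → twistFactor (x <ᵇ y) qinv) (labA-↑ʳ r) (labA-↑ʳ i)

  κA-↑ʳ : ∀ t → κA (n ↑ʳ t) ≡ κC t
  κA-↑ʳ t = ≡.cong₂ (λ x y → twistFactor (x <ᵇ y) q) (labA-↑ʳ j) (labA-↑ʳ t)

  Aᵢⱼ≐scale : ∀ a b {x y} → ρA a ≡ x → κA b ≡ y → Aᵢⱼ a b ≐ scale x (scale y (var a b))
  Aᵢⱼ≐scale a b ≡x ≡y = trans (twist≐scale q qinv (labA n p) (n ↑ʳ i) (n ↑ʳ j) (Amat n p) a b)
                              (reflexive (≡.cong₂ (λ x y → scale x (scale y (var a b))) ≡x ≡y))

  topLeft-Aᵢⱼ : ∀ k l → topLeft Aᵢⱼ k l ≐ scaleMat qinv (A0mat n p) k l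
  topLeft-Aᵢⱼ k l = trans (Aᵢⱼ≐scale (k ↑ˡ p) (l ↑ˡ p) (ρA-↑ˡ k) (κA-↑ˡ l))
                         (scale-congʳ qinv (scale-identity _))

  topRight-Aᵢⱼ : ∀ l t → topRight Aᵢⱼ l t ≐ scale (κC t) (scale qinv (var (l ↑ˡ p) (n ↑ʳ t)))
  topRight-Aᵢⱼ l t = trans (Aᵢⱼ≐scale (l ↑ˡ p) (n ↑ʳ t) (ρA-↑ˡ l) (κA-↑ʳ t)) (scale-comm qinv (κC t) _)

  bottomLeft-Aᵢⱼ : ∀ r k → bottomLeft Aᵢⱼ r k ≐ scale (ρC r) (var (n ↑ʳ r) (k ↑ˡ p))
  bottomLeft-Aᵢⱼ r k = trans (Aᵢⱼ≐scale (n ↑ʳ r) (k ↑ˡ p) (ρA-↑ʳ r) (κA-↑ˡ k))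
                            (scale-congʳ (ρC r) (scale-identity _))

  bottomRight-Aᵢⱼ : ∀ r t → bottomRight Aᵢⱼ r t ≐ scale (ρC r) (scale (κC t) (var (n ↑ʳ r) (n ↑ʳ t)))
  bottomRight-Aᵢⱼ r t = Aᵢⱼ≐scale (n ↑ʳ r) (n ↑ʳ t) (ρA-↑ʳ r) (κA-↑ʳ t)

  Aᵢⱼ-constantFree : ConstantFree Aᵢⱼ
  Aᵢⱼ-constantFree a b = K.trans (twist≐scale q qinv (labA n p) (n ↑ʳ i) (n ↑ʳ j) (Amat n p) a b [])
                                (K.trans (K.*-congˡ (K.zeroʳ _)) (K.zeroʳ _))

  schur-Aᵢⱼ : ∀ r t → schur Aᵢⱼ r t ≐ Cᵢⱼ r t
  schur-Aᵢⱼ r t = begin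
    schur Aᵢⱼ r t
      ≈⟨ +-cong (bottomRight-Aᵢⱼ r t) (sumFin-cong (λ k → sumFin-cong (λ l → schur-term k l))) ⟩
    scale (ρC r) (scale (κC t) (var (n ↑ʳ r) (n ↑ʳ t))) ⊕
      sumFin (λ k → sumFin (λ l → scale (ρC r) (scale (κC t) (BInvE k l))))
      ≈⟨ +-congˡ (trans (sumFin-cong (λ k → sym (scale²-sumFin (BInvE k))))
                        (sym (scale²-sumFin (λ k → sumFin (BInvE k))))) ⟩
    scale (ρC r) (scale (κC t) (var (n ↑ʳ r) (n ↑ʳ t))) ⊕
      scale (ρC r) (scale (κC t) (sumFin (λ k → sumFin (BInvE k))))
      ≈⟨ trans (scale-congʳ (ρC r) (scale-⊕ (κC t) _ _)) (scale-⊕ (ρC r) _ _) ⟨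
    scale (ρC r) (scale (κC t) (Cmat n p qinv r t))
      ≈⟨ twist≐scale q qinv (labC n p) i j (Cmat n p qinv) r t ⟨
    Cᵢⱼ r t ∎
    where
      BInvE : Fin n → Fin n → PS (n ℕ.+ p)
      BInvE k l = var (n ↑ʳ r) (k ↑ˡ p) ⊛
                  (invIminus (scaleMat qinv (A0mat n p)) k l ⊛ scale qinv (var (l ↑ˡ p) (n ↑ʳ t)))

      scale²-sumFin : ∀ {k} (f : Fin k → PS (n ℕ.+ p)) →
                      scale (ρC r) (scale (κC t) (sumFin f)) ≐ sumFin (λ a → scale (ρC r) (scale (κC t) (f a)))
      scale²-sumFin f = trans (scale-congʳ (ρC r) (scale-sumFin (κC t) f)) (scale-sumFin (ρC r) (λ a → scale (κC t) (f a)))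

      schur-term : ∀ k l → bottomLeft Aᵢⱼ r k ⊛ (invIminus (topLeft Aᵢⱼ) k l ⊛ topRight Aᵢⱼ l t) ≐
                           scale (ρC r) (scale (κC t) (BInvE k l))
      schur-term k l = begin
        bottomLeft Aᵢⱼ r k ⊛ (invIminus (topLeft Aᵢⱼ) k l ⊛ topRight Aᵢⱼ l t)
          ≈⟨ ⊛-cong (bottomLeft-Aᵢⱼ r k)
                    (⊛-cong (invIminus-cong (topLeft-constantFree {Aᵢⱼ} Aᵢⱼ-constantFree) topLeft-Aᵢⱼ k l)
                            (topRight-Aᵢⱼ l t)) ⟩
        scale (ρC r) B ⊛ (Inv k l ⊛ scale (κC t) E)
          ≈⟨ scale-⊛ (ρC r) B _ ⟩
        scale (ρC r) (B ⊛ (Inv k l ⊛ scale (κC t) E))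
          ≈⟨ scale-congʳ (ρC r) (⊛-cong refl (⊛-scale (κC t) (Inv k l) E)) ⟩
        scale (ρC r) (B ⊛ scale (κC t) (Inv k l ⊛ E))
          ≈⟨ scale-congʳ (ρC r) (⊛-scale (κC t) B _) ⟩
        scale (ρC r) (scale (κC t) (BInvE k l)) ∎
        where
          B E : PS (n ℕ.+ p)
          B = var (n ↑ʳ r) (k ↑ˡ p)
          E = scale qinv (var (l ↑ˡ p) (n ↑ʳ t))
          Inv : Mat (n ℕ.+ p) n
          Inv = invIminus (scaleMat qinv (A0mat n p))

  invIminus-Aᵢⱼ≐Cᵢⱼ : ∀ r t → invIminus Aᵢⱼ (n ↑ʳ r) (n ↑ʳ t) ≐ invIminus Cᵢⱼ r t
  invIminus-Aᵢⱼ≐Cᵢⱼ r t = trans (invIminus-schur {Aᵢⱼ} Aᵢⱼ-constantFree r t)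
                              (invIminus-cong (schur-constantFree {Aᵢⱼ} Aᵢⱼ-constantFree) schur-Aᵢⱼ r t)

open import Data.Nat using (_+_)
open CommutativeRing using (Carrier; _≈_; _*_; 1#)
open PowerSeries using (Word; invIminus; twist; labA; labC; Amat; Cmat)

proposition7p2 : ∀ {c ℓ} (R : CommutativeRing c ℓ) →
    (n p : ℕ) → 1 ≤ n → 1 ≤ p →
    (q qinv : Carrier R) → _≈_ R (_*_ R q qinv) (1# R) →
    (i j : Fin p) → (i' j' : Fin p) → (w : Word R (n + p)) →
    _≈_ R
      (invIminus R (twist R q qinv (labA R n p) (n ↑ʳ i) (n ↑ʳ j) (Amat R n p)) (n ↑ʳ i') (n ↑ʳ j') w)
      (invIminus R (twist R q qinv (labC R n p) i j (Cmat R n p qinv)) i' j' w)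
proposition7p2 R n p _ _ q qinv _ i j i' j' =
  TwistedSchurComplement.invIminus-Aᵢⱼ≐Cᵢⱼ R n p q qinv i j i' j'
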